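{- Let $(X,\mathcal{B})$ be a projective plane of order $q$, and let $G=(X,\mathcal{B})$ be the hypergraph whose vertices are the points of $X$ and whose edges are the lines in $\mathcal{B}$. If $q$ is odd, then $G$ is minimal non-odd-bipartite.
   Context: A projective plane of order $q$ consists of a set $X$ of $q^2+q+1$ points and a set $\mathcal{B}$ of $(q+1)$-subsets of $X$ (lines) such that any two points lie on a unique line. The hypergraph $G$ is then $(q+1)$-uniform. For $k$ even, a $k$-uniform hypergraph $G$ is odd-bipartite if there is a bipartition $\{U,U^c\}$ of $V(G)$ such that every edge meets $U$ (and hence $U^c$) in an odd number of vertices. It is minimal non-odd-bipartite if it is not odd-bipartite but $G-e$ (delete the edge $e$ from the edge set) is odd-bipartite for every edge $e$. -}

module Defs where

open import Data.Nat using (ℕ; suc; _+_; _*_)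
open import Data.Fin using (Fin)
open import Data.Fin.Subset using (Subset; _∈_; _∩_; ∣_∣)
open import Data.Product using (Σ; _×_; ∃)
open import Relation.Binary.PropositionalEquality using (_≡_)
open import Relation.Nullary using (¬_)
open import Function.Definitions using (Injective)

Odd : ℕ → Set
Odd n = ∃ λ k → n ≡ suc (2 * k)

Hypergraph : ℕ → ℕ → Set
Hypergraph n m = Fin m → Subset n

Uniform : ∀ {n m} → ℕ → Hypergraph n m → Set
Uniform k E = ∀ e → ∣ E e ∣ ≡ k

-- odd-bipartite: some U ⊆ V meets every edge in an odd number of vertices
-- (for k even U^c then also meets every edge oddly).
OddBipartite : ∀ {n m} → Hypergraph n m → Set
OddBipartite {n} E = Σ (Subset n) λ U → ∀ e → Odd ∣ U ∩ E e ∣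

OddBipartiteWithout : ∀ {n m} → Hypergraph n m → Fin m → Set
OddBipartiteWithout {n} E e₀ =
  Σ (Subset n) λ U → ∀ e → ¬ (e ≡ e₀) → Odd ∣ U ∩ E e ∣

MinimalNonOddBipartite : ∀ {n m} → Hypergraph n m → Set
MinimalNonOddBipartite E = ¬ OddBipartite E × (∀ e → OddBipartiteWithout E e)

-- Projective plane of order q: q²+q+1 points; the set of lines is given by
-- an injective enumeration (so it is a set of distinct subsets) of
-- (q+1)-subsets, and any two distinct points lie on a unique line.
record ProjectivePlane (q m : ℕ) : Set where
  field
    line       : Fin m → Subset (q * q + q + 1)
    line-inj   : Injective _≡_ _≡_ line
    line-size  : ∀ l → ∣ line l ∣ ≡ q + 1
    two-points : ∀ x y → ¬ (x ≡ y) →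
                 Σ (Fin m) λ l → (x ∈ line l × y ∈ line l) ×
                   (∀ l′ → x ∈ line l′ → y ∈ line l′ → l′ ≡ l)

module Submission where

-- Let deg x be the number of lines through the point x. The lines through x cover every other
-- point exactly once, so Σ_{l ∋ x} ∣U ∩ l∣ = ∣U∣ + [x ∈ U](deg x - 1) for every set of points U.
-- For U the whole plane this gives deg x = q + 1, and double counting point-line incidences then
-- gives Σ_l ∣U ∩ l∣ = (q + 1)∣U∣ and shows that there are q² + q + 1 lines. If every line met U
-- in an odd number of points, the left side would be a sum of q² + q + 1 odd numbers, hence
-- odd, while (q + 1)∣U∣ is even for odd q.
-- After deleting a line e₀, the set U = e₀ works: another line e has a point x off e₀; the
-- q + 1 lines through x meet e₀ at most once each and together cover its q + 1 points, so
-- each of them, e in particular, meets e₀ exactly once.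

open import Defs
open import Data.Bool.Base using (true; false; if_then_else_)
open import Data.Fin.Base using (Fin; zero; suc; punchIn)
open import Data.Fin.Properties using (_≟_; suc-injective; punchInᵢ≢i)
open import Data.Fin.Subset using (Subset; _∈_; _∉_; _∩_; ∣_∣; ⊤; ⊥; inside; outside)
open import Data.Fin.Subset.Properties using (_∈?_; x∈p∩q⁻; ∈⊤; ∣⊤∣≡n; ∣⊥∣≡0; ∩-identityˡ; p⊆q⇒∣p∣≤∣q∣)
open import Data.Nat.Base using (ℕ; zero; suc; _+_; _*_; _≤_; _<_; z≤n; s≤s; NonZero; >-nonZero; >-nonZero⁻¹; parity)
open import Data.Nat.Properties
  using (+-*-semiring; m≤n+m; ≤-antisym; +-mono-≤; +-monoʳ-≤; +-monoˡ-<; +-cancelˡ-≡; +-cancelʳ-≡; +-cancelʳ-≤;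
         +-identityʳ; *-identityˡ; *-identityʳ; *-zeroʳ; *-cancelʳ-≡; module ≤-Reasoning)
open import Algebra.Properties.Semiring.Sum +-*-semiring
  using (sum; sum-syntax; sum-cong-≗; sum-remove; sum-replicate-zero; ∑-comm; *-distribˡ-sum; *-distribʳ-sum)
open import Data.Nat.Tactic.RingSolver using (solve-∀)
open import Data.Parity.Base as ℙ using (0ℙ; 1ℙ)
open import Data.Parity.Properties using (+-homo-+; *-homo-*; *-idem; p+p≡0ℙ) renaming (*-zeroʳ to ℙ-*-zeroʳ)
open import Data.Product using (Σ; _,_; ∃; _×_)
open import Data.Vec.Base using ([]; _∷_; lookup; here; there)
open import Data.Vec.Properties using ([]=⇒lookup; lookup⇒[]=)
open import Function.Base using (_∘_)
open import Relation.Binary.PropositionalEquality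
open import Relation.Nullary using (¬_; yes; no; contradiction)

∑-const : ∀ n c → ∑[ i < n ] c ≡ n * c
∑-const zero    c = refl
∑-const (suc n) c = cong (c +_) (∑-const n c)

∑-agree-off : ∀ {n} (f g : Fin n → ℕ) i → (∀ j → j ≢ i → f j ≡ g j) → sum f + g i ≡ sum g + f i
∑-agree-off {suc n} f g i f≗g = begin
  sum f + g i                      ≡⟨ cong (_+ g i) (sum-remove f) ⟩
  f i + sum (f ∘ punchIn i) + g i  ≡⟨ cong (λ s → f i + s + g i) (sum-cong-≗ (λ j → f≗g _ (punchInᵢ≢i i j))) ⟩
  f i + sum (g ∘ punchIn i) + g i  ≡⟨ swap (f i) _ (g i) ⟩
  g i + sum (g ∘ punchIn i) + f i  ≡⟨ cong (_+ f i) (sum-remove g) ⟨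
  sum g + f i                      ∎
  where
  open ≡-Reasoning
  swap : ∀ a s b → a + s + b ≡ b + s + a
  swap = solve-∀

∑-supported-at : ∀ {n} (f : Fin n → ℕ) i → (∀ j → j ≢ i → f j ≡ 0) → sum f ≡ f i
∑-supported-at {n} f i f≗0 = begin
  sum f                   ≡⟨ +-identityʳ (sum f) ⟨
  sum f + 0               ≡⟨ ∑-agree-off f (λ _ → 0) i f≗0 ⟩
  ∑[ j < n ] 0 + f i      ≡⟨ cong (_+ f i) (sum-replicate-zero n) ⟩
  f i                     ∎
  where open ≡-Reasoning

∑-mono-≤ : ∀ {n} {f g : Fin n → ℕ} → (∀ i → f i ≤ g i) → sum f ≤ sum g
∑-mono-≤ {zero}  f≤g = z≤n
∑-mono-≤ {suc n} f≤g = +-mono-≤ (f≤g zero) (∑-mono-≤ (f≤g ∘ suc))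

+-mono-≤-≡⇒≡ˡ : ∀ {a b c d} → a ≤ c → b ≤ d → a + b ≡ c + d → a ≡ c
+-mono-≤-≡⇒≡ˡ {a} {b} {c} {d} a≤c b≤d a+b≡c+d =
  ≤-antisym a≤c (+-cancelʳ-≤ d c a (subst (_≤ a + d) a+b≡c+d (+-monoʳ-≤ a b≤d)))

∑-mono-≤-≡⇒≗ : ∀ {n} {f g : Fin n → ℕ} → (∀ i → f i ≤ g i) → sum f ≡ sum g → ∀ i → f i ≡ g i
∑-mono-≤-≡⇒≗ {suc n} {f} {g} f≤g ∑f≡∑g = λ where
    zero    → head≡
    (suc i) → ∑-mono-≤-≡⇒≗ (f≤g ∘ suc) tail≡ i
  where
  head≡ : f zero ≡ g zero
  head≡ = +-mono-≤-≡⇒≡ˡ (f≤g zero) (∑-mono-≤ (f≤g ∘ suc)) ∑f≡∑g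
  tail≡ : sum (f ∘ suc) ≡ sum (g ∘ suc)
  tail≡ = +-cancelˡ-≡ (g zero) _ _ (subst (λ a → a + sum (f ∘ suc) ≡ sum g) head≡ ∑f≡∑g)

𝟙 : ∀ {n} → Subset n → Fin n → ℕ
𝟙 p x = if lookup p x then 1 else 0

module _ {n : ℕ} {p : Subset n} {x : Fin n} where

  x∈p⇒𝟙≡1 : x ∈ p → 𝟙 p x ≡ 1
  x∈p⇒𝟙≡1 x∈p = cong (λ b → if b then 1 else 0) ([]=⇒lookup x∈p)

  x∉p⇒𝟙≡0 : x ∉ p → 𝟙 p x ≡ 0
  x∉p⇒𝟙≡0 x∉p with lookup p x in eq
  ... | false = refl
  ... | true  = contradiction (lookup⇒[]= x p eq) x∉p

  𝟙-idem : 𝟙 p x * 𝟙 p x ≡ 𝟙 p x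
  𝟙-idem with lookup p x
  ... | false = refl
  ... | true  = refl

  𝟙*≤𝟙 : ∀ {a} → (x ∈ p → a ≤ 1) → 𝟙 p x * a ≤ 𝟙 p x
  𝟙*≤𝟙 {a} a≤1 with x ∈? p
  ... | yes x∈p = subst (λ k → k * a ≤ k) (sym (x∈p⇒𝟙≡1 x∈p)) (subst (_≤ 1) (sym (*-identityˡ a)) (a≤1 x∈p))
  ... | no  x∉p = subst (λ k → k * a ≤ k) (sym (x∉p⇒𝟙≡0 x∉p)) z≤n

𝟙⊤≡1 : ∀ {n} (x : Fin n) → 𝟙 ⊤ x ≡ 1
𝟙⊤≡1 {n} x = x∈p⇒𝟙≡1 {p = ⊤ {n}} ∈⊤

∣p∣≡∑𝟙 : ∀ {n} (p : Subset n) → ∣ p ∣ ≡ sum (𝟙 p)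
∣p∣≡∑𝟙 []            = refl
∣p∣≡∑𝟙 (inside ∷ p)  = cong suc (∣p∣≡∑𝟙 p)
∣p∣≡∑𝟙 (outside ∷ p) = ∣p∣≡∑𝟙 p

∣p∩q∣≡∑𝟙*𝟙 : ∀ {n} (p q : Subset n) → ∣ p ∩ q ∣ ≡ ∑[ x < n ] (𝟙 p x * 𝟙 q x)
∣p∩q∣≡∑𝟙*𝟙 []            []            = refl
∣p∩q∣≡∑𝟙*𝟙 (inside ∷ p)  (inside ∷ q)  = cong suc (∣p∩q∣≡∑𝟙*𝟙 p q)
∣p∩q∣≡∑𝟙*𝟙 (inside ∷ p)  (outside ∷ q) = ∣p∩q∣≡∑𝟙*𝟙 p q
∣p∩q∣≡∑𝟙*𝟙 (outside ∷ p) (_ ∷ q)       = ∣p∩q∣≡∑𝟙*𝟙 p q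

∣p∣≤1 : ∀ {n} (p : Subset n) → (∀ {y z} → y ∈ p → z ∈ p → y ≡ z) → ∣ p ∣ ≤ 1
∣p∣≤1 []            _    = z≤n
∣p∣≤1 (outside ∷ p) uniq = ∣p∣≤1 p (λ y∈p z∈p → suc-injective (uniq (there y∈p) (there z∈p)))
∣p∣≤1 {suc n} (inside ∷ p) uniq = s≤s (subst (∣ p ∣ ≤_) (∣⊥∣≡0 n) (p⊆q⇒∣p∣≤∣q∣ p⊆⊥))
  where
  p⊆⊥ : ∀ {y} → y ∈ p → y ∈ ⊥
  p⊆⊥ y∈p with () ← uniq here (there y∈p)

∣p∩q∣<∣p∣⇒∃∈∉ : ∀ {n} (p q : Subset n) → ∣ p ∩ q ∣ < ∣ p ∣ → ∃ λ x → x ∈ p × x ∉ q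
∣p∩q∣<∣p∣⇒∃∈∉ (inside ∷ p)  (outside ∷ q) _ = zero , here , λ ()
∣p∩q∣<∣p∣⇒∃∈∉ (inside ∷ p)  (inside ∷ q)  (s≤s lt) with ∣p∩q∣<∣p∣⇒∃∈∉ p q lt
... | x , x∈p , x∉q = suc x , there x∈p , λ { (there x∈q) → x∉q x∈q }
∣p∩q∣<∣p∣⇒∃∈∉ (outside ∷ p) (_ ∷ q)       lt with ∣p∩q∣<∣p∣⇒∃∈∉ p q lt
... | x , x∈p , x∉q = suc x , there x∈p , λ { (there x∈q) → x∉q x∈q }

Odd⇒parity≡1ℙ : ∀ {n} → Odd n → parity n ≡ 1ℙ
Odd⇒parity≡1ℙ (k , refl) = trans (+-homo-+ 1 (2 * k)) (cong (1ℙ ℙ.+_) (*-homo-* 2 k))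

parity-∑-odd : ∀ {n} (f : Fin n → ℕ) → (∀ i → parity (f i) ≡ 1ℙ) → parity (sum f) ≡ parity n
parity-∑-odd {zero}  f odd = refl
parity-∑-odd {suc n} f odd = begin
  parity (f zero + sum (f ∘ suc))           ≡⟨ +-homo-+ (f zero) _ ⟩
  parity (f zero) ℙ.+ parity (sum (f ∘ suc)) ≡⟨ cong₂ ℙ._+_ (odd zero) (parity-∑-odd (f ∘ suc) (odd ∘ suc)) ⟩
  1ℙ ℙ.+ parity n                           ≡⟨ +-homo-+ 1 n ⟨
  parity (suc n)                            ∎
  where open ≡-Reasoning

parity[n*n+n+1]≡1ℙ : ∀ n → parity (n * n + n + 1) ≡ 1ℙ
parity[n*n+n+1]≡1ℙ n = begin
  parity (n * n + n + 1)                        ≡⟨ +-homo-+ (n * n + n) 1 ⟩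
  parity (n * n + n) ℙ.+ 1ℙ                     ≡⟨ cong (ℙ._+ 1ℙ) (+-homo-+ (n * n) n) ⟩
  parity (n * n) ℙ.+ parity n ℙ.+ 1ℙ            ≡⟨ cong (λ p → p ℙ.+ parity n ℙ.+ 1ℙ) (*-homo-* n n) ⟩
  parity n ℙ.* parity n ℙ.+ parity n ℙ.+ 1ℙ     ≡⟨ cong (λ p → p ℙ.+ parity n ℙ.+ 1ℙ) (*-idem (parity n)) ⟩
  parity n ℙ.+ parity n ℙ.+ 1ℙ                  ≡⟨ cong (ℙ._+ 1ℙ) (p+p≡0ℙ (parity n)) ⟩
  1ℙ                                            ∎
  where open ≡-Reasoning

module Incidence {n m : ℕ} (line : Fin m → Subset n) where

  deg : Fin n → ℕ
  deg x = ∑[ l < m ] 𝟙 (line l) x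

  double-count : ∀ (w : Fin m → ℕ) U →
    ∑[ l < m ] (w l * ∣ U ∩ line l ∣) ≡ ∑[ y < n ] (𝟙 U y * ∑[ l < m ] (w l * 𝟙 (line l) y))
  double-count w U = begin
    ∑[ l < m ] (w l * ∣ U ∩ line l ∣)                    ≡⟨ sum-cong-≗ (λ l → cong (w l *_) (∣p∩q∣≡∑𝟙*𝟙 U (line l))) ⟩
    ∑[ l < m ] (w l * ∑[ y < n ] (𝟙 U y * 𝟙 (line l) y)) ≡⟨ sum-cong-≗ (λ l → *-distribˡ-sum (w l) (λ y → 𝟙 U y * 𝟙 (line l) y)) ⟩
    ∑[ l < m ] ∑[ y < n ] (w l * (𝟙 U y * 𝟙 (line l) y)) ≡⟨ sum-cong-≗ (λ l → sum-cong-≗ (λ y → swap (w l) (𝟙 U y) _)) ⟩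
    ∑[ l < m ] ∑[ y < n ] (𝟙 U y * (w l * 𝟙 (line l) y)) ≡⟨ ∑-comm (λ l y → 𝟙 U y * (w l * 𝟙 (line l) y)) ⟩
    ∑[ y < n ] ∑[ l < m ] (𝟙 U y * (w l * 𝟙 (line l) y)) ≡⟨ sum-cong-≗ (λ y → *-distribˡ-sum (𝟙 U y) (λ l → w l * 𝟙 (line l) y)) ⟨
    ∑[ y < n ] (𝟙 U y * ∑[ l < m ] (w l * 𝟙 (line l) y)) ∎
    where
    open ≡-Reasoning
    swap : ∀ a b c → a * (b * c) ≡ b * (a * c)
    swap = solve-∀

IsLinearSpace : ∀ {n m} → (Fin m → Subset n) → Set
IsLinearSpace {n} {m} line = ∀ (x y : Fin n) → ¬ (x ≡ y) →
  Σ (Fin m) λ l → (x ∈ line l × y ∈ line l) × (∀ l′ → x ∈ line l′ → y ∈ line l′ → l′ ≡ l)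

module LinearSpace {n m : ℕ} {line : Fin m → Subset n} (two-points : IsLinearSpace line) where

  open Incidence line

  common-point-unique : ∀ {e e′ y z} → e ≢ e′ →
    y ∈ line e → y ∈ line e′ → z ∈ line e → z ∈ line e′ → y ≡ z
  common-point-unique {e} {e′} {y} {z} e≢e′ y∈e y∈e′ z∈e z∈e′ with y ≟ z
  ... | yes y≡z = y≡z
  ... | no  y≢z with two-points y z y≢z
  ...   | _ , _ , unique = contradiction (trans (unique e y∈e z∈e) (sym (unique e′ y∈e′ z∈e′))) e≢e′

  ∣line∩line∣≤1 : ∀ {e e′} → e ≢ e′ → ∣ line e ∩ line e′ ∣ ≤ 1
  ∣line∩line∣≤1 {e} {e′} e≢e′ = ∣p∣≤1 (line e ∩ line e′) λ {y} {z} y∈ z∈ →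
    let y∈e , y∈e′ = x∈p∩q⁻ (line e) (line e′) y∈
        z∈e , z∈e′ = x∈p∩q⁻ (line e) (line e′) z∈
    in common-point-unique e≢e′ y∈e y∈e′ z∈e z∈e′

  lines-through-two : ∀ {x y} → x ≢ y → ∑[ l < m ] (𝟙 (line l) x * 𝟙 (line l) y) ≡ 1
  lines-through-two {x} {y} x≢y with two-points x y x≢y
  ... | l₀ , (x∈l₀ , y∈l₀) , unique = begin
    ∑[ l < m ] (𝟙 (line l) x * 𝟙 (line l) y) ≡⟨ ∑-supported-at (λ l → 𝟙 (line l) x * 𝟙 (line l) y) l₀ off-l₀ ⟩
    𝟙 (line l₀) x * 𝟙 (line l₀) y            ≡⟨ cong₂ _*_ (x∈p⇒𝟙≡1 x∈l₀) (x∈p⇒𝟙≡1 y∈l₀) ⟩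
    1                                         ∎
    where
    open ≡-Reasoning
    off-l₀ : ∀ l → l ≢ l₀ → 𝟙 (line l) x * 𝟙 (line l) y ≡ 0
    off-l₀ l l≢l₀ with x ∈? line l | y ∈? line l
    ... | yes x∈l | yes y∈l = contradiction (unique l x∈l y∈l) l≢l₀
    ... | no  x∉l | _       = cong (_* 𝟙 (line l) y) (x∉p⇒𝟙≡0 x∉l)
    ... | yes _   | no  y∉l = trans (cong (𝟙 (line l) x *_) (x∉p⇒𝟙≡0 y∉l)) (*-zeroʳ (𝟙 (line l) x))

  pencil-sum : ∀ U x →
    ∑[ l < m ] (𝟙 (line l) x * ∣ U ∩ line l ∣) + 𝟙 U x ≡ ∣ U ∣ + 𝟙 U x * deg x
  pencil-sum U x = begin
    ∑[ l < m ] (𝟙 (line l) x * ∣ U ∩ line l ∣) + 𝟙 U x ≡⟨ cong (_+ 𝟙 U x) (double-count (λ l → 𝟙 (line l) x) U) ⟩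
    ∑[ y < n ] (𝟙 U y * through-x y) + 𝟙 U x          ≡⟨ ∑-agree-off (λ y → 𝟙 U y * through-x y) (𝟙 U) x off-x ⟩
    sum (𝟙 U) + 𝟙 U x * through-x x                    ≡⟨ cong₂ _+_ (∣p∣≡∑𝟙 U) (cong (𝟙 U x *_) deg≡through-x) ⟨
    ∣ U ∣ + 𝟙 U x * deg x                              ∎
    where
    open ≡-Reasoning
    through-x : Fin n → ℕ
    through-x y = ∑[ l < m ] (𝟙 (line l) x * 𝟙 (line l) y)
    off-x : ∀ y → y ≢ x → 𝟙 U y * through-x y ≡ 𝟙 U y
    off-x y y≢x = trans (cong (𝟙 U y *_) (lines-through-two (y≢x ∘ sym))) (*-identityʳ _)
    deg≡through-x : deg x ≡ through-x x
    deg≡through-x = sym (sum-cong-≗ (λ l → 𝟙-idem {p = line l}))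

module PositiveOrder {q m : ℕ} (P : ProjectivePlane q m) .{{_ : NonZero q}} where

  open ProjectivePlane P
  open Incidence line
  open LinearSpace two-points

  all-points : Subset (q * q + q + 1)
  all-points = ⊤

  ∣all-points∩line∣≡q+1 : ∀ l → ∣ all-points ∩ line l ∣ ≡ q + 1
  ∣all-points∩line∣≡q+1 l = trans (cong ∣_∣ (∩-identityˡ (line l))) (line-size l)

  deg≡q+1 : ∀ x → deg x ≡ q + 1
  deg≡q+1 x = solve-for-deg (begin
    deg x * (q + 1) + 1
      ≡⟨ cong₂ _+_ (*-distribʳ-sum (q + 1) (λ l → 𝟙 (line l) x)) (sym (𝟙⊤≡1 x)) ⟩
    ∑[ l < m ] (𝟙 (line l) x * (q + 1)) + 𝟙 all-points x
      ≡⟨ cong (_+ 𝟙 all-points x) (sum-cong-≗ (λ l → cong (𝟙 (line l) x *_) (∣all-points∩line∣≡q+1 l))) ⟨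
    ∑[ l < m ] (𝟙 (line l) x * ∣ all-points ∩ line l ∣) + 𝟙 all-points x
      ≡⟨ pencil-sum all-points x ⟩
    ∣ all-points ∣ + 𝟙 all-points x * deg x
      ≡⟨ cong₂ (λ a b → a + b * deg x) (∣⊤∣≡n (q * q + q + 1)) (𝟙⊤≡1 x) ⟩
    q * q + q + 1 + 1 * deg x
      ∎)
    where
    open ≡-Reasoning
    solve-for-deg : ∀ {d} → d * (q + 1) + 1 ≡ q * q + q + 1 + 1 * d → d ≡ q + 1
    solve-for-deg {d} eq = *-cancelʳ-≡ d (q + 1) q (+-cancelʳ-≡ (d + 1) (d * q) ((q + 1) * q) (begin
      d * q + (d + 1)           ≡⟨ expandˡ d q ⟩
      d * (q + 1) + 1           ≡⟨ eq ⟩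
      q * q + q + 1 + 1 * d     ≡⟨ expandʳ d q ⟩
      (q + 1) * q + (d + 1)     ∎))
      where
      expandˡ : ∀ d q → d * q + (d + 1) ≡ d * (q + 1) + 1
      expandˡ = solve-∀
      expandʳ : ∀ d q → q * q + q + 1 + 1 * d ≡ (q + 1) * q + (d + 1)
      expandʳ = solve-∀

  ∑∣U∩line∣≡∣U∣*[q+1] : ∀ U → ∑[ l < m ] ∣ U ∩ line l ∣ ≡ ∣ U ∣ * (q + 1)
  ∑∣U∩line∣≡∣U∣*[q+1] U = begin
    ∑[ l < m ] ∣ U ∩ line l ∣
      ≡⟨ sum-cong-≗ (λ l → *-identityˡ ∣ U ∩ line l ∣) ⟨
    ∑[ l < m ] (1 * ∣ U ∩ line l ∣)
      ≡⟨ double-count (λ _ → 1) U ⟩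
    ∑[ y < q * q + q + 1 ] (𝟙 U y * ∑[ l < m ] (1 * 𝟙 (line l) y))
      ≡⟨ sum-cong-≗ (λ y → cong (𝟙 U y *_) (deg′≡q+1 y)) ⟩
    ∑[ y < q * q + q + 1 ] (𝟙 U y * (q + 1))
      ≡⟨ *-distribʳ-sum (q + 1) (𝟙 U) ⟨
    sum (𝟙 U) * (q + 1)
      ≡⟨ cong (_* (q + 1)) (∣p∣≡∑𝟙 U) ⟨
    ∣ U ∣ * (q + 1)
      ∎
    where
    open ≡-Reasoning
    deg′≡q+1 : ∀ y → ∑[ l < m ] (1 * 𝟙 (line l) y) ≡ q + 1
    deg′≡q+1 y = trans (sum-cong-≗ (λ l → *-identityˡ (𝟙 (line l) y))) (deg≡q+1 y)

  #lines≡#points : m ≡ q * q + q + 1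
  #lines≡#points = *-cancelʳ-≡ m _ (q + 1) {{>-nonZero (m≤n+m 1 q)}} (begin
    m * (q + 1)                         ≡⟨ ∑-const m (q + 1) ⟨
    ∑[ l < m ] (q + 1)                  ≡⟨ sum-cong-≗ ∣all-points∩line∣≡q+1 ⟨
    ∑[ l < m ] ∣ all-points ∩ line l ∣  ≡⟨ ∑∣U∩line∣≡∣U∣*[q+1] all-points ⟩
    ∣ all-points ∣ * (q + 1)            ≡⟨ cong (_* (q + 1)) (∣⊤∣≡n (q * q + q + 1)) ⟩
    (q * q + q + 1) * (q + 1)           ∎)
    where open ≡-Reasoning

  pencil-meets-once : ∀ {x e₀ e} → x ∉ line e₀ → x ∈ line e → ∣ line e₀ ∩ line e ∣ ≡ 1
  pencil-meets-once {x} {e₀} {e} x∉e₀ x∈e = begin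
    ∣ line e₀ ∩ line e ∣                  ≡⟨ *-identityˡ _ ⟨
    1 * ∣ line e₀ ∩ line e ∣              ≡⟨ cong (_* ∣ line e₀ ∩ line e ∣) (x∈p⇒𝟙≡1 x∈e) ⟨
    𝟙 (line e) x * ∣ line e₀ ∩ line e ∣   ≡⟨ ∑-mono-≤-≡⇒≗ term≤𝟙 ∑terms≡deg e ⟩
    𝟙 (line e) x                          ≡⟨ x∈p⇒𝟙≡1 x∈e ⟩
    1                                     ∎
    where
    open ≡-Reasoning
    term≤𝟙 : ∀ l → 𝟙 (line l) x * ∣ line e₀ ∩ line l ∣ ≤ 𝟙 (line l) x
    term≤𝟙 l = 𝟙*≤𝟙 λ x∈l → ∣line∩line∣≤1 λ e₀≡l → x∉e₀ (subst (λ k → x ∈ line k) (sym e₀≡l) x∈l)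
    ∑terms≡deg : ∑[ l < m ] (𝟙 (line l) x * ∣ line e₀ ∩ line l ∣) ≡ deg x
    ∑terms≡deg = begin
      S                                    ≡⟨ +-identityʳ S ⟨
      S + 0                                ≡⟨ cong (S +_) (x∉p⇒𝟙≡0 x∉e₀) ⟨
      S + 𝟙 (line e₀) x                    ≡⟨ pencil-sum (line e₀) x ⟩
      ∣ line e₀ ∣ + 𝟙 (line e₀) x * deg x  ≡⟨ cong₂ (λ a b → a + b * deg x) (line-size e₀) (x∉p⇒𝟙≡0 x∉e₀) ⟩
      q + 1 + 0                            ≡⟨ +-identityʳ (q + 1) ⟩
      q + 1                                ≡⟨ deg≡q+1 x ⟨
      deg x                                ∎
      where
      S : ℕ
      S = ∑[ l < m ] (𝟙 (line l) x * ∣ line e₀ ∩ line l ∣)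

  lines-meet-once : ∀ {e₀ e} → e ≢ e₀ → ∣ line e₀ ∩ line e ∣ ≡ 1
  lines-meet-once {e₀} {e} e≢e₀ =
    let x , x∈e , x∉e₀ = ∣p∩q∣<∣p∣⇒∃∈∉ (line e) (line e₀) line-e⊈e₀
    in pencil-meets-once x∉e₀ x∈e
    where
    open ≤-Reasoning
    line-e⊈e₀ : ∣ line e ∩ line e₀ ∣ < ∣ line e ∣
    line-e⊈e₀ = begin-strict
      ∣ line e ∩ line e₀ ∣ ≤⟨ ∣line∩line∣≤1 e≢e₀ ⟩
      1                    <⟨ +-monoˡ-< 1 (>-nonZero⁻¹ q) ⟩
      q + 1                ≡⟨ line-size e ⟨
      ∣ line e ∣           ∎

  odd-bipartite-without : ∀ e₀ → OddBipartiteWithout line e₀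
  odd-bipartite-without e₀ = line e₀ , λ e e≢e₀ → 0 , lines-meet-once e≢e₀

  not-odd-bipartite : Odd q → ¬ OddBipartite line
  not-odd-bipartite q-odd (U , U-odd) = contradiction (begin
    1ℙ                                     ≡⟨ parity[n*n+n+1]≡1ℙ q ⟨
    parity (q * q + q + 1)                 ≡⟨ cong parity #lines≡#points ⟨
    parity m                               ≡⟨ parity-∑-odd (λ l → ∣ U ∩ line l ∣) (Odd⇒parity≡1ℙ ∘ U-odd) ⟨
    parity (∑[ l < m ] ∣ U ∩ line l ∣)     ≡⟨ cong parity (∑∣U∩line∣≡∣U∣*[q+1] U) ⟩
    parity (∣ U ∣ * (q + 1))               ≡⟨ *-homo-* ∣ U ∣ (q + 1) ⟩
    parity ∣ U ∣ ℙ.* parity (q + 1)        ≡⟨ cong (parity ∣ U ∣ ℙ.*_) (+-homo-+ q 1) ⟩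
    parity ∣ U ∣ ℙ.* (parity q ℙ.+ 1ℙ)     ≡⟨ cong (λ p → parity ∣ U ∣ ℙ.* (p ℙ.+ 1ℙ)) (Odd⇒parity≡1ℙ q-odd) ⟩
    parity ∣ U ∣ ℙ.* 0ℙ                    ≡⟨ ℙ-*-zeroʳ (parity ∣ U ∣) ⟩
    0ℙ                                     ∎) λ ()
    where open ≡-Reasoning

theorem4p11 : (q m : ℕ) (P : ProjectivePlane q m) → Odd q →
    MinimalNonOddBipartite (ProjectivePlane.line P)
theorem4p11 q m P q-odd@(k , refl) = not-odd-bipartite q-odd , odd-bipartite-without
  where open PositiveOrder P
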